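{- Let $\mathcal{P}$ be a partition regular class and let $\mathcal{F}$ be a $\mathbb{P}_\mathcal{P}$-filter. For every condition $c = (\vec{R}, \sigma, X) \in \mathcal{F}$, the set $G_\mathcal{F}$ is $\vec{R}$-transitive.
   Context: Finite sets are identified with binary strings $\sigma$ via $F_\sigma = \{x<|\sigma|:\sigma(x)=1\}$; for strings $\sigma,\tau$, $\sigma\cup\tau$ is the string of length $\max(|\sigma|,|\tau|)$ coding $F_\sigma \cup F_\tau$. A tournament on $\mathbb{N}$ is an irreflexive relation $R$ with exactly one of $R(a,b),R(b,a)$ for distinct $a,b$. A set is $R$-transitive if $R$ restricted to it is transitive; for a finite sequence $\vec R$ of tournaments, $\vec R$-transitive means $R$-transitive for each $R$ in $\vec R$. For a finite $R$-transitive set $F$, adjoin endpoints $-\infty,+\infty$ with $R(-\infty,x)$, $R(x,+\infty)$ for all $x$; for $a,b \in F \cup\{\pm\infty\}$, the interval $(a,b)$ is $\{x : R(a,x) \wedge R(x,b)\}$, minimal in $F$ if $(a,b)\cap F=\emptyset$. "$X$ is included in a minimal $\vec R$-interval of $\sigma$" means: for each $R$ in $\vec R$, $X$ is contained in a single minimal $R$-interval of $F_\sigma$. A class $\mathcal{P}\subseteq 2^\omega$ is partition regular if it is non-empty, upward closed, and whenever $X\in\mathcal{P}$ and $X \subseteq Y_1\cup\dots\cup Y_k$, some $Y_i \in \mathcal{P}$. $\mathbb{P}_\mathcal{P}$ is the set of triples $(\vec R,\sigma,X)$ with $\vec R$ a finite sequence of tournaments, $\sigma$ a binary string, $X \subseteq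 \mathbb{N}$, such that $X \cap\{0,\dots,|\sigma|\}=\emptyset$, $X\in\mathcal{P}$, $F_\sigma \cup\{y\}$ is $\vec R$-transitive for every $y \in X$, and $X$ is included in a minimal $\vec R$-interval of $\sigma$. Order: $(\vec S,\tau,Y) \le (\vec R,\sigma,X)$ iff $\sigma \preceq \tau$, $Y \subseteq X$, $F_\tau \setminus F_\sigma \subseteq X$, and $\vec S$ extends $\vec R$ (every tournament of $\vec R$ occurs in $\vec S$). A filter is a non-empty $\mathcal{F}\subseteq\mathbb{P}_\mathcal{P}$, upward closed under $\le$, any two members of which have a common extension in $\mathcal{F}$. $G_\mathcal{F} = \bigcup_{(\vec R,\sigma,X)\in\mathcal{F}} F_\sigma$. -}

module Defs where

open import Level using (Level; 0ℓ) renaming (suc to lsuc)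
open import Data.Nat using (ℕ; zero; suc; _<_)
open import Data.Bool using (Bool; true; false)
open import Data.List using (List; []; _∷_; _++_; length)
open import Data.List.Relation.Unary.All using (All)
open import Data.List.Relation.Unary.Any using (Any)
open import Data.List.Membership.Propositional using (_∈_)
open import Data.Product using (Σ; ∃; _×_; _,_)
open import Data.Sum using (_⊎_)
open import Data.Empty using (⊥)
open import Data.Unit using (⊤)
open import Relation.Nullary using (¬_)
open import Relation.Binary.PropositionalEquality using (_≡_)

SetN : Set₁
SetN = ℕ → Set

_⊆_ : SetN → SetN → Set
X ⊆ Y = ∀ x → X x → Y x

Rel : Set₁
Rel = ℕ → ℕ → Set

record IsTournament (R : Rel) : Set where
  field
    irrefl : ∀ a → ¬ R a a
    total  : ∀ a b → ¬ (a ≡ b) → R a b ⊎ R b a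
    asym   : ∀ a b → R a b → ¬ R b a

-- Finite set coded by a binary string: F_σ = { x < |σ| : σ(x) = 1 }.
F : List Bool → SetN
F []      _       = ⊥
F (b ∷ σ) zero    = b ≡ true
F (b ∷ σ) (suc x) = F σ x

Transitive-on : ∀ {ℓ} → Rel → (ℕ → Set ℓ) → Set ℓ
Transitive-on R A = ∀ a b c → A a → A b → A c → R a b → R b c → R a c

VTransitive-on : ∀ {ℓ} → List Rel → (ℕ → Set ℓ) → Set (lsuc 0ℓ Level.⊔ ℓ)
VTransitive-on Rs A = All (λ R → Transitive-on R A) Rs

_∪｛_｝ : SetN → ℕ → SetN
(A ∪｛ y ｝) x = A x ⊎ x ≡ y

data Ext : Set where
  -∞  : Ext
  fin : ℕ → Ext
  +∞  : Ext

ExtR : Rel → Ext → Ext → Set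
ExtR R -∞      (fin _) = ⊤
ExtR R -∞      +∞      = ⊤
ExtR R (fin x) (fin y) = R x y
ExtR R (fin _) +∞      = ⊤
ExtR R _       _       = ⊥

Interval : Rel → Ext → Ext → SetN
Interval R a b x = ExtR R a (fin x) × ExtR R (fin x) b

InExt : SetN → Ext → Set
InExt A -∞      = ⊤
InExt A (fin x) = A x
InExt A +∞      = ⊤

InMinimalInterval : Rel → SetN → SetN → Set
InMinimalInterval R A X =
  Σ Ext λ a → Σ Ext λ b →
    InExt A a × InExt A b ×
    (∀ x → Interval R a b x → ¬ A x) ×
    (X ⊆ Interval R a b)

InMinimalVInterval : List Rel → List Bool → SetN → Set₁
InMinimalVInterval Rs σ X = All (λ R → InMinimalInterval R (F σ) X) Rs

-- Partition regular classes (k ranges over all finite lists of sets).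
record PartitionRegular (P : SetN → Set) : Set₁ where
  field
    nonempty  : Σ SetN P
    upward    : ∀ X Y → X ⊆ Y → P X → P Y
    partition : ∀ X (Ys : List SetN) → P X →
                (∀ x → X x → Any (λ Y → Y x) Ys) → Any P Ys

record Condition (P : SetN → Set) : Set₁ where
  constructor cond
  field
    Rs   : List Rel
    σ    : List Bool
    X    : SetN
    tour : All IsTournament Rs
    above : ∀ x → X x → length σ < x
    inP  : P X
    trans : ∀ y → X y → VTransitive-on Rs (F σ ∪｛ y ｝)
    minimal : InMinimalVInterval Rs σ X

open Condition public

_≼_ : List Bool → List Bool → Set
σ ≼ τ = ∃ λ ρ → τ ≡ σ ++ ρ

_≤C_ : ∀ {P} → Condition P → Condition P → Set₁
d ≤C c = (σ c ≼ σ d) × (X d ⊆ X c) ×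
         (∀ x → F (σ d) x → ¬ F (σ c) x → X c x) ×
         (∀ R → R ∈ Rs c → R ∈ Rs d)

record IsFilter {P} (𝓕 : Condition P → Set) : Set₁ where
  field
    nonempty : Σ (Condition P) 𝓕
    upward   : ∀ c d → 𝓕 c → c ≤C d → 𝓕 d
    directed : ∀ c d → 𝓕 c → 𝓕 d →
               Σ (Condition P) λ e → 𝓕 e × e ≤C c × e ≤C d

G : ∀ {P} → (Condition P → Set) → ℕ → Set₁
G 𝓕 x = Σ _ λ c → 𝓕 c × F (σ c) x

-- Directedness of 𝓕 puts any three points of G_𝓕 into F_σ of one condition
-- e ∈ 𝓕 extending c. And F_σ is already R-transitive for every condition:
-- X is nonempty by partition regularity, and F_σ ∪ {y} is R-transitive for y ∈ X.
module Submission where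

open import Defs
open import Data.List.Membership.Propositional using (_∈_)
open import Data.Nat using (zero; suc)
open import Data.Nat.Properties using (_≟_)
open import Data.List using ([]; _∷_; _++_)
open import Data.List.Relation.Unary.All using (lookup; tabulate)
open import Data.Product using (Σ; _×_; _,_)
open import Data.Sum using (inj₁; inj₂)
open import Relation.Nullary using (¬_; yes; no; contradiction)
open import Relation.Binary.PropositionalEquality using (refl)

tournament-stable : ∀ {R} → IsTournament R → ∀ a c → ¬ ¬ R a c → R a c
tournament-stable T a c ¬¬Rac with a ≟ c
... | yes refl = contradiction (IsTournament.irrefl T a) ¬¬Rac
... | no a≢c with IsTournament.total T a c a≢c
...   | inj₁ Rac = Rac
...   | inj₂ Rca = contradiction (IsTournament.asym T c a Rca) ¬¬Rac

partitionRegular⇒nonempty : ∀ {P} → PartitionRegular P →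
                            ∀ {X} → P X → ¬ (∀ x → ¬ X x)
partitionRegular⇒nonempty PR {X} PX empty
  with PartitionRegular.partition PR X [] PX (λ x Xx → contradiction Xx (empty x))
... | ()

F-++ : ∀ σ ρ x → F σ x → F (σ ++ ρ) x
F-++ (b ∷ σ) ρ zero    p = p
F-++ (b ∷ σ) ρ (suc x) p = F-++ σ ρ x p

F-mono-≼ : ∀ {σ τ} → σ ≼ τ → ∀ x → F σ x → F τ x
F-mono-≼ {σ} (ρ , refl) = F-++ σ ρ

module _ {P : SetN → Set} where

  -- Constructively X only fails to be empty, which suffices because a
  -- tournament is double-negation stable.
  σ-transitive : PartitionRegular P → (e : Condition P) →
                 ∀ {R} → R ∈ Rs e → Transitive-on R (F (σ e))
  σ-transitive PR e R∈ a b c a∈ b∈ c∈ Rab Rbc =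
    tournament-stable (lookup (tour e) R∈) a c λ ¬Rac →
      partitionRegular⇒nonempty PR (inP e) λ y Xy →
        ¬Rac (lookup (trans e y Xy) R∈ a b c (inj₁ a∈) (inj₁ b∈) (inj₁ c∈) Rab Rbc)

  record Refines (d c : Condition P) : Set₁ where
    constructor refines
    field
      F-⊆  : ∀ x → F (σ c) x → F (σ d) x
      Rs-⊆ : ∀ R → R ∈ Rs c → R ∈ Rs d

  ≤C⇒refines : ∀ {c d} → d ≤C c → Refines d c
  ≤C⇒refines (σ≼τ , _ , _ , Rs⊆) = refines (F-mono-≼ σ≼τ) Rs⊆

  refines-trans : ∀ {c d e} → Refines e d → Refines d c → Refines e c
  refines-trans (refines Fde Rde) (refines Fcd Rcd) =
    refines (λ x p → Fde x (Fcd x p)) (λ R p → Rde R (Rcd R p))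

  module _ {𝓕 : Condition P → Set} (FF : IsFilter 𝓕) where

    refine-to-G : ∀ {c} → 𝓕 c → ∀ {x} → G 𝓕 x →
                  Σ (Condition P) λ e → 𝓕 e × Refines e c × F (σ e) x
    refine-to-G {c} 𝓕c {x} (d , 𝓕d , x∈) with IsFilter.directed FF c d 𝓕c 𝓕d
    ... | e , 𝓕e , e≤c , e≤d =
      e , 𝓕e , ≤C⇒refines {c} {e} e≤c , Refines.F-⊆ (≤C⇒refines {d} {e} e≤d) x x∈

lemma4p3 : (P : SetN → Set) → PartitionRegular P →
           (𝓕 : Condition P → Set) → IsFilter 𝓕 →
           (c : Condition P) → 𝓕 c →
           VTransitive-on (Rs c) (G 𝓕)
lemma4p3 P PR 𝓕 FF c 𝓕c = tabulate λ R∈ a b d a∈G b∈G d∈G Rab Rbd →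
  let e₁ , 𝓕e₁ , e₁⊒c  , a∈e₁ = refine-to-G FF 𝓕c  a∈G
      e₂ , 𝓕e₂ , e₂⊒e₁ , b∈e₂ = refine-to-G FF 𝓕e₁ b∈G
      e  , _   , e⊒e₂  , d∈e  = refine-to-G FF 𝓕e₂ d∈G
      e⊒e₁ = refines-trans e⊒e₂ e₂⊒e₁
      open Refines
  in σ-transitive PR e (Rs-⊆ (refines-trans e⊒e₁ e₁⊒c) _ R∈) a b d
       (F-⊆ e⊒e₁ a a∈e₁) (F-⊆ e⊒e₂ b b∈e₂) d∈e Rab Rbd
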